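{- Let $X$ be a regular graph of valency $d$. If $d$ is even or $X$ is class I, then the complete generalized truncation of $X$ admits a 1-factorization (a partition of its edge set into perfect matchings).
   Context: Generalized truncation of a graph $X$ (without isolated vertices): take a matching $M_0$ with $|M_0|=|E(X)|$ (on $2|E(X)|$ new vertices) and a bijection $F:E(X)\to M_0$; for each edge $e$ of $X$ with ends $u,v$, label one end of $F(e)$ by $u$ and the other by $v$. For $v\in V(X)$, the cluster $\mathrm{cl}(v)$ is the set of vertices labelled $v$; insert a graph $\mathrm{con}(v)$ (constituent) on $\mathrm{cl}(v)$. The result is a generalized truncation; it is the complete generalized truncation if every constituent is a complete graph. A graph is class I if its chromatic index equals its maximum valency. -}

module Defs where

open import Data.Nat using (ℕ; _+_; _≤_; _⊔_)
open import Data.Bool using (Bool; true; false; if_then_else_)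
open import Data.Fin using (Fin)
open import Data.List using (List; map; foldr; allFin)
open import Data.Nat.ListAction using (sum)
open import Data.Product using (Σ; ∃; _×_; _,_; proj₁; proj₂)
open import Data.Sum using (_⊎_)
open import Relation.Binary.PropositionalEquality using (_≡_; _≢_)

record Graph (n : ℕ) : Set where
  field
    adj    : Fin n → Fin n → Bool
    sym    : ∀ u v → adj u v ≡ adj v u
    irrefl : ∀ v → adj v v ≡ false
open Graph public

Adj : ∀ {n} → Graph n → Fin n → Fin n → Set
Adj G u v = adj G u v ≡ true

degree : ∀ {n} → Graph n → Fin n → ℕ
degree {n} G v = sum (map (λ u → if adj G v u then 1 else 0) (allFin n))

Regular : ∀ {n} → Graph n → ℕ → Set
Regular {n} G d = ∀ v → degree G v ≡ d

maxValency : ∀ {n} → Graph n → ℕ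
maxValency {n} G = foldr _⊔_ 0 (map (degree G) (allFin n))

EdgeColouring : ∀ {n} → Graph n → ℕ → Set
EdgeColouring {n} G k =
  Σ (Fin n → Fin n → Fin k) λ c →
    (∀ u v → Adj G u v → c u v ≡ c v u) ×
    (∀ u v w → Adj G u v → Adj G u w → v ≢ w → c u v ≢ c u w)

IsChromaticIndex : ∀ {n} → Graph n → ℕ → Set
IsChromaticIndex G k = EdgeColouring G k × (∀ j → EdgeColouring G j → k ≤ j)

ClassI : ∀ {n} → Graph n → Set
ClassI G = IsChromaticIndex G (maxValency G)

-- The new vertices (ends of the matching
-- M0, one matching edge F(e) per edge e of X) are identified with darts:
-- the end of F({u,v}) labelled u is the dart (u , v).  Cluster cl(u) is the
-- set of darts with first coordinate u.
TVertex : ∀ {n} → Graph n → Set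
TVertex {n} G = Σ (Fin n × Fin n) λ p → Adj G (proj₁ p) (proj₂ p)

-- adjacency in the complete generalized truncation:
--   (u,v) ~ (v,u)                       edge F({u,v}) of the matching M0
--   (u,v) ~ (u,w) with v ≢ w            edge of the complete constituent con(u)
TAdj : ∀ {n} (G : Graph n) → TVertex G → TVertex G → Set
TAdj G (p , _) (q , _) =
  (proj₁ q ≡ proj₂ p × proj₂ q ≡ proj₁ p) ⊎ (proj₁ p ≡ proj₁ q × proj₂ p ≢ proj₂ q)

OneFactorization : {V : Set} → (V → V → Set) → Set
OneFactorization {V} A =
  Σ ℕ λ k → Σ (V → V → Fin k) λ f →
    (∀ x y → A x y → f x y ≡ f y x) ×
    (∀ x i → Σ V λ y → A x y × f x y ≡ i × (∀ z → A x z → f x z ≡ i → z ≡ y))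

-- Give the dart (u , v) the label ℓ(u , v) ∈ Fin d, where ℓ(u , _) is a
-- bijection from the neighbours of u, and fix a commutative Latin square ∙ on
-- Fin d.  Colour the edge joining the darts (u , v) and (u , w) of a cluster
-- by ℓ(u , v) ∙ ℓ(u , w), and the matching edge at (u , v) by
-- ℓ(u , v) ∙ ℓ(u , v).  Each dart then sees every colour exactly once, and the
-- matching edge {(u , v) , (v , u)} gets a single colour as soon as the
-- diagonal entries ℓ(u , v) ∙ ℓ(u , v) and ℓ(v , u) ∙ ℓ(v , u) agree.  If X is
-- class I, let ℓ be a d-edge-colouring, which is symmetric, and ∙ addition
-- modulo d.  If d is even, any ℓ works with a Latin square of constant
-- diagonal: addition modulo the odd number d - 1, extended by a new symbol
-- placed on the diagonal.
module Submission where

open import Defs renaming (sym to adj-sym)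
open import Data.Nat
  using (ℕ; zero; suc; _+_; _*_; _<_; _≤_; _⊔_; z≤n; NonZero; ∣_-_∣)
open import Data.Nat.Properties
  using ( ≤-refl; ≤-reflexive; ≤-<-trans; <⇒≱; ⊔-lub
        ; +-comm; +-identityʳ; ∣m+n-m+o∣≡∣n-o∣; ∣m-n∣≡0⇒m≡n; ∣m-n∣≤m⊔n
        ; *-distribʳ-∣-∣; *-distribˡ-∣-∣ )
open import Data.Nat.DivMod using (_%_; _/_; m%n<n; m≡m%n+[m/n]*n)
open import Data.Nat.Divisibility using (_∣_; n∣m*n; >⇒∤; ∣m+n∣m⇒∣n; ∣1⇒≡1)
open import Data.Nat.Coprimality using (Coprime; coprime-divisor)
open import Data.Nat.Primality using (irreducible[2])
open import Data.Nat.ListAction using (sum)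
open import Data.Bool using (Bool; true; false; if_then_else_)
import Data.Bool.Properties as Bool
open import Data.Fin using (Fin; zero; suc; toℕ; fromℕ<; punchOut)
open import Data.Fin.Properties
  using ( _≟_; any?; toℕ-injective; toℕ-fromℕ<; toℕ<n; suc-injective
        ; punchOut-injective; injective⇒≤ )
open import Data.List using (List; []; _∷_; length; lookup; map; foldr; filter; allFin)
import Data.List.Relation.Unary.All as All
open import Data.List.Relation.Unary.AllPairs using (_∷_)
open import Data.List.Relation.Unary.Any using (index)
open import Data.List.Relation.Unary.Any.Properties using (lookup-index)
open import Data.List.Relation.Unary.Unique.Propositional using (Unique)
open import Data.List.Relation.Unary.Unique.Propositional.Properties
  using (allFin⁺; filter⁺)
open import Data.List.Membership.Propositional using (_∈_)
open import Data.List.Membership.Propositional.Properties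
  using (∈-allFin; ∈-lookup; ∈-filter⁺; ∈-filter⁻)
open import Data.Product using (∃; _×_; _,_; proj₁; proj₂)
open import Data.Sum using (_⊎_; inj₁; inj₂)
open import Function using (_∘_)
open import Relation.Nullary using (¬_; Dec; yes; no; contradiction)
open import Relation.Binary.PropositionalEquality
  using (_≡_; _≢_; refl; sym; trans; cong; cong₂; subst; module ≡-Reasoning)
open import Axiom.UniquenessOfIdentityProofs using (module Decidable⇒UIP)

private
  variable
    k m n : ℕ

injective⇒surjective : (f : Fin m → Fin k) → k ≤ m →
                       (∀ {a b} → f a ≡ f b → a ≡ b) → ∀ y → ∃ λ x → f x ≡ y
injective⇒surjective {m} {suc k} f k<m f-injective y with any? (λ x → f x ≟ y)
... | yes found = found
... | no ¬found = contradiction (injective⇒≤ f′-injective) (<⇒≱ k<m)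
  where
  missed : ∀ x → y ≢ f x
  missed x y≡fx = ¬found (x , sym y≡fx)

  f′ : Fin m → Fin k
  f′ x = punchOut (missed x)

  f′-injective : ∀ {a b} → f′ a ≡ f′ b → a ≡ b
  f′-injective = f-injective ∘ punchOut-injective (missed _) (missed _)

%-≡⇒∣∣-∣ : ∀ a b k .{{_ : NonZero k}} → a % k ≡ b % k → k ∣ ∣ a - b ∣
%-≡⇒∣∣-∣ a b k a%k≡b%k =
  subst (k ∣_) (sym ∣a-b∣≡∣a/k-b/k∣*k) (n∣m*n ∣ a / k - b / k ∣)
  where
  open ≡-Reasoning
  ∣a-b∣≡∣a/k-b/k∣*k : ∣ a - b ∣ ≡ ∣ a / k - b / k ∣ * k
  ∣a-b∣≡∣a/k-b/k∣*k = begin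
    ∣ a - b ∣
      ≡⟨ cong₂ ∣_-_∣ (m≡m%n+[m/n]*n a k) (m≡m%n+[m/n]*n b k) ⟩
    ∣ a % k + a / k * k - b % k + b / k * k ∣
      ≡⟨ cong (λ r → ∣ a % k + a / k * k - r + b / k * k ∣) a%k≡b%k ⟨
    ∣ a % k + a / k * k - a % k + b / k * k ∣
      ≡⟨ ∣m+n-m+o∣≡∣n-o∣ (a % k) _ _ ⟩
    ∣ a / k * k - b / k * k ∣
      ≡⟨ *-distribʳ-∣-∣ k (a / k) (b / k) ⟨
    ∣ a / k - b / k ∣ * k
      ∎

∣-<⇒≡0 : ∀ {k t} → k ∣ t → t < k → t ≡ 0
∣-<⇒≡0 {t = zero}  _   _   = refl
∣-<⇒≡0 {t = suc _} k∣t t<k = contradiction k∣t (>⇒∤ t<k)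

∣∣-∣⇒≡ : ∀ {a b k} → a < k → b < k → k ∣ ∣ a - b ∣ → a ≡ b
∣∣-∣⇒≡ {a} {b} a<k b<k k∣∣a-b∣ =
  ∣m-n∣≡0⇒m≡n (∣-<⇒≡0 k∣∣a-b∣ (≤-<-trans (∣m-n∣≤m⊔n a b) (⊔-lub a<k b<k)))

odd⇒coprime-2 : ¬ 2 ∣ k → Coprime k 2
odd⇒coprime-2 2∤k (d∣k , d∣2) with irreducible[2] d∣2
... | inj₁ d≡1  = d≡1
... | inj₂ refl = contradiction d∣k 2∤k

even⇒pred-odd : 2 ∣ suc k → ¬ 2 ∣ k
even⇒pred-odd {k} 2∣1+k 2∣k =
  contradiction (∣1⇒≡1 (∣m+n∣m⇒∣n (subst (2 ∣_) (+-comm 1 k) 2∣1+k) 2∣k)) λ ()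

record CommutativeLatinSquare (k : ℕ) : Set where
  infixl 7 _∙_
  field
    _∙_       : Fin k → Fin k → Fin k
    ∙-comm    : ∀ a b → a ∙ b ≡ b ∙ a
    ∙-cancelˡ : ∀ a {b c} → a ∙ b ≡ a ∙ c → b ≡ c

  ∙-solveˡ : ∀ a i → ∃ λ b → a ∙ b ≡ i
  ∙-solveˡ a = injective⇒surjective (a ∙_) ≤-refl (∙-cancelˡ a)

infixl 6 _⊕_

_⊕_ : Fin k → Fin k → Fin k
_⊕_ {suc k} a b = fromℕ< (m%n<n (toℕ a + toℕ b) (suc k))

toℕ-⊕ : ∀ (a b : Fin (suc k)) → toℕ (a ⊕ b) ≡ (toℕ a + toℕ b) % suc k
toℕ-⊕ a b = toℕ-fromℕ< _

⊕-comm : ∀ (a b : Fin k) → a ⊕ b ≡ b ⊕ a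
⊕-comm {suc k} a b = toℕ-injective (begin
  toℕ (a ⊕ b)                  ≡⟨ toℕ-⊕ a b ⟩
  (toℕ a + toℕ b) % suc k      ≡⟨ cong (_% suc k) (+-comm (toℕ a) (toℕ b)) ⟩
  (toℕ b + toℕ a) % suc k      ≡⟨ toℕ-⊕ b a ⟨
  toℕ (b ⊕ a)                  ∎)
  where open ≡-Reasoning

⊕-≡⇒∣∣-∣ : ∀ (a b c d : Fin (suc k)) → a ⊕ b ≡ c ⊕ d →
           suc k ∣ ∣ toℕ a + toℕ b - toℕ c + toℕ d ∣
⊕-≡⇒∣∣-∣ {k} a b c d e = %-≡⇒∣∣-∣ (toℕ a + toℕ b) (toℕ c + toℕ d) (suc k)
  (trans (sym (toℕ-⊕ a b)) (trans (cong toℕ e) (toℕ-⊕ c d)))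

⊕-cancelˡ : ∀ (a : Fin k) {b c} → a ⊕ b ≡ a ⊕ c → b ≡ c
⊕-cancelˡ {suc k} a {b} {c} e = toℕ-injective (∣∣-∣⇒≡ (toℕ<n b) (toℕ<n c)
  (subst (suc k ∣_) (∣m+n-m+o∣≡∣n-o∣ (toℕ a) (toℕ b) (toℕ c))
    (⊕-≡⇒∣∣-∣ a b a c e)))

cyclic : (k : ℕ) → CommutativeLatinSquare k
cyclic k = record { _∙_ = _⊕_ ; ∙-comm = ⊕-comm ; ∙-cancelˡ = ⊕-cancelˡ }

⊕-double-injective : ¬ 2 ∣ k → ∀ {a b : Fin k} → a ⊕ a ≡ b ⊕ b → a ≡ b
⊕-double-injective {suc k} 2∤k {a} {b} e = toℕ-injective (∣∣-∣⇒≡ (toℕ<n a) (toℕ<n b)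
  (coprime-divisor (odd⇒coprime-2 2∤k)
    (subst (suc k ∣_) ∣2a-2b∣≡2∣a-b∣ (⊕-≡⇒∣∣-∣ a a b b e))))
  where
  twice : ∀ x → x + x ≡ 2 * x
  twice x = cong (x +_) (sym (+-identityʳ x))
  ∣2a-2b∣≡2∣a-b∣ : ∣ toℕ a + toℕ a - toℕ b + toℕ b ∣ ≡ 2 * ∣ toℕ a - toℕ b ∣
  ∣2a-2b∣≡2∣a-b∣ = trans (cong₂ ∣_-_∣ (twice (toℕ a)) (twice (toℕ b)))
                         (sym (*-distribˡ-∣-∣ 2 (toℕ a) (toℕ b)))

-- The new symbol zero goes on the diagonal, and each displaced diagonal entry
-- a ∙ a moves to the new row and column; the new row is Latin because the
-- diagonal of S is injective.
module DiagonalExtension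
  (S : CommutativeLatinSquare k)
  (diagonal-injective : ∀ {a b} → CommutativeLatinSquare._∙_ S a a
                                 ≡ CommutativeLatinSquare._∙_ S b b → a ≡ b)
  where

  open CommutativeLatinSquare S

  infixl 7 _∙⁺_

  _∙⁺_ : Fin (suc k) → Fin (suc k) → Fin (suc k)
  zero  ∙⁺ zero  = zero
  zero  ∙⁺ suc b = suc (b ∙ b)
  suc a ∙⁺ zero  = suc (a ∙ a)
  suc a ∙⁺ suc b with a ≟ b
  ... | yes _ = zero
  ... | no  _ = suc (a ∙ b)

  ∙⁺-diagonal : ∀ a → a ∙⁺ a ≡ zero
  ∙⁺-diagonal zero    = refl
  ∙⁺-diagonal (suc a) with a ≟ a
  ... | yes _   = refl
  ... | no  a≢a = contradiction refl a≢a

  ∙⁺-comm : ∀ a b → a ∙⁺ b ≡ b ∙⁺ a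
  ∙⁺-comm zero    zero    = refl
  ∙⁺-comm zero    (suc b) = refl
  ∙⁺-comm (suc a) zero    = refl
  ∙⁺-comm (suc a) (suc b) with a ≟ b | b ≟ a
  ... | yes _   | yes _   = refl
  ... | no  _   | no  _   = cong suc (∙-comm a b)
  ... | yes a≡b | no  b≢a = contradiction (sym a≡b) b≢a
  ... | no  a≢b | yes b≡a = contradiction (sym b≡a) a≢b

  ∙⁺-cancelˡ : ∀ a {b c} → a ∙⁺ b ≡ a ∙⁺ c → b ≡ c
  ∙⁺-cancelˡ zero    {zero}  {zero}  _ = refl
  ∙⁺-cancelˡ zero    {suc b} {suc c} e = cong suc (diagonal-injective (suc-injective e))
  ∙⁺-cancelˡ (suc a) {zero}  {zero}  _ = refl
  ∙⁺-cancelˡ (suc a) {zero}  {suc c} e with a ≟ c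
  ∙⁺-cancelˡ (suc a) {zero}  {suc c} () | yes _
  ... | no a≢c = contradiction (∙-cancelˡ a (suc-injective e)) a≢c
  ∙⁺-cancelˡ (suc a) {suc b} {zero}  e = sym (∙⁺-cancelˡ (suc a) (sym e))
  ∙⁺-cancelˡ (suc a) {suc b} {suc c} e with a ≟ b | a ≟ c
  ∙⁺-cancelˡ (suc a) {suc b} {suc c} _  | yes refl | yes refl = refl
  ∙⁺-cancelˡ (suc a) {suc b} {suc c} () | yes _    | no  _
  ∙⁺-cancelˡ (suc a) {suc b} {suc c} () | no  _    | yes _
  ∙⁺-cancelˡ (suc a) {suc b} {suc c} e  | no  _    | no  _ =
    cong suc (∙-cancelˡ a (suc-injective e))

  extension : CommutativeLatinSquare (suc k)
  extension = record { _∙_ = _∙⁺_ ; ∙-comm = ∙⁺-comm ; ∙-cancelˡ = ∙⁺-cancelˡ }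

record Enumeration {A : Set} (P : A → Set) (k : ℕ) : Set where
  field
    element            : Fin k → A
    element-satisfies  : ∀ i → P (element i)
    element-injective  : ∀ {i j} → element i ≡ element j → i ≡ j
    element-surjective : ∀ {x} → P x → ∃ λ i → element i ≡ x

lookup-injective : ∀ {A : Set} {xs : List A} → Unique xs →
                   ∀ {i j} → lookup xs i ≡ lookup xs j → i ≡ j
lookup-injective (_ ∷ _)      {zero}  {zero}  _ = refl
lookup-injective (x∉xs ∷ _)   {zero}  {suc j} e = contradiction e (All.lookup x∉xs (∈-lookup j))
lookup-injective (x∉xs ∷ _)   {suc i} {zero}  e = contradiction e (All.lookup x∉xs (∈-lookup i) ∘ sym)
lookup-injective (_ ∷ unique) {suc i} {suc j} e = cong suc (lookup-injective unique e)

unique⇒enumeration : ∀ {A : Set} {P : A → Set} (xs : List A) → Unique xs →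
                     (∀ {x} → x ∈ xs → P x) → (∀ {x} → P x → x ∈ xs) →
                     Enumeration P (length xs)
unique⇒enumeration xs unique sound complete = record
  { element            = lookup xs
  ; element-satisfies  = sound ∘ ∈-lookup
  ; element-injective  = lookup-injective unique
  ; element-surjective = λ px → let x∈xs = complete px in index x∈xs , sym (lookup-index x∈xs)
  }

adjacent? : (X : Graph n) → ∀ u v → Dec (Adj X u v)
adjacent? X u v = adj X u v Bool.≟ true

neighbours : Graph n → Fin n → List (Fin n)
neighbours {n} X u = filter (adjacent? X u) (allFin n)

length-filter-≡true : ∀ {A : Set} (p : A → Bool) xs →
  length (filter (λ x → p x Bool.≟ true) xs) ≡ sum (map (λ x → if p x then 1 else 0) xs)
length-filter-≡true p []       = refl
length-filter-≡true p (x ∷ xs) with p x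
... | true  = cong suc (length-filter-≡true p xs)
... | false = length-filter-≡true p xs

regular⇒enumeration : ∀ (X : Graph n) {d} → Regular X d → ∀ u → Enumeration (Adj X u) d
regular⇒enumeration {n} X reg u =
  subst (Enumeration (Adj X u)) (trans (length-filter-≡true (adj X u) (allFin n)) (reg u))
    (unique⇒enumeration (neighbours X u) (filter⁺ _ (allFin⁺ n))
      (proj₂ ∘ ∈-filter⁻ (adjacent? X u) {xs = allFin n})
      (∈-filter⁺ (adjacent? X u) (∈-allFin _)))

LocallyInjective : ∀ {A : Set} → Graph n → (Fin n → Fin n → A) → Set
LocallyInjective X ℓ = ∀ {u v w} → Adj X u v → Adj X u w → ℓ u v ≡ ℓ u w → v ≡ w

record NeighbourhoodLabelling (X : Graph n) (k : ℕ) : Set where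
  field
    label            : Fin n → Fin n → Fin k
    label-injective  : LocallyInjective X label
    label-surjective : ∀ u i → ∃ λ v → Adj X u v × label u v ≡ i

regular⇒labelling : ∀ (X : Graph n) {d} → Regular X d → k ≤ d →
  (label : Fin n → Fin n → Fin k) → LocallyInjective X label →
  NeighbourhoodLabelling X k
regular⇒labelling X reg k≤d label label-injective = record
  { label            = label
  ; label-injective  = label-injective
  ; label-surjective = surjective
  }
  where
  surjective : ∀ u i → ∃ λ v → Adj X u v × label u v ≡ i
  surjective u i =
    let (j , labelled) = injective⇒surjective (label u ∘ element) k≤d
          (element-injective ∘ label-injective (element-satisfies _) (element-satisfies _)) i
    in element j , element-satisfies j , labelled
    where open Enumeration (regular⇒enumeration X reg u)

positionLabelling : ∀ (X : Graph n) {q} → Regular X (suc q) → NeighbourhoodLabelling X (suc q)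
positionLabelling {n} X {q} reg = regular⇒labelling X reg ≤-refl position position-injective
  where
  open module E u = Enumeration (regular⇒enumeration X reg u)

  position : Fin n → Fin n → Fin (suc q)
  position u v with any? (λ i → element u i ≟ v)
  ... | yes (i , _) = i
  ... | no  _       = zero

  element-position : ∀ {u v} → Adj X u v → element u (position u v) ≡ v
  element-position {u} {v} p with any? (λ i → element u i ≟ v)
  ... | yes (_ , found) = found
  ... | no  ¬found      = contradiction (element-surjective u p) ¬found

  position-injective : LocallyInjective X position
  position-injective {u} p q e =
    trans (sym (element-position p)) (trans (cong (element u) e) (element-position q))

properColouring⇒oneFactorization : ∀ {V : Set} {A : V → V → Set}
  (colour : V → V → Fin k) →
  (∀ x y → A x y → colour x y ≡ colour y x) →
  (∀ {x y z} → A x y → A x z → colour x y ≡ colour x z → y ≡ z) →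
  (∀ x i → ∃ λ y → A x y × colour x y ≡ i) →
  OneFactorization A
properColouring⇒oneFactorization {k} colour symmetric injective surjective =
  k , colour , symmetric , factor
  where
  factor = λ x i → let (y , xy , coloured) = surjective x i in
    y , xy , coloured , λ z xz z-coloured → injective xz xy (trans z-coloured (sym coloured))

module _ {X : Graph n} where

  Adj-irrelevant : ∀ {u v} (p q : Adj X u v) → p ≡ q
  Adj-irrelevant = Decidable⇒UIP.≡-irrelevant Bool._≟_

  Adj-sym : ∀ {u v} → Adj X u v → Adj X v u
  Adj-sym {u} {v} p = trans (adj-sym X v u) p

  Adj⇒≢ : ∀ {u v} → Adj X u v → u ≢ v
  Adj⇒≢ {u} p refl = contradiction (trans (sym (irrefl X u)) p) λ ()

  dart-≡ : ∀ {u u′ v v′} {p : Adj X u v} {p′ : Adj X u′ v′} →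
           u ≡ u′ → v ≡ v′ → _≡_ {A = TVertex X} ((u , v) , p) ((u′ , v′) , p′)
  dart-≡ {u} {v = v} refl refl = cong ((u , v) ,_) (Adj-irrelevant _ _)

  -- The neighbour y of the dart (u , v) leads to the neighbour peer of u in X:
  -- w if y = (u , w) lies in the cluster of u, and v if y = (v , u) is the
  -- matching partner.
  peer : TVertex X → TVertex X → Fin n
  peer ((u , _) , _) ((u′ , w) , _) with u′ ≟ u
  ... | yes _ = w
  ... | no  _ = u′

  peer-matched : ∀ {u v} (p : Adj X u v) (q : Adj X v u) →
                 peer ((u , v) , p) ((v , u) , q) ≡ v
  peer-matched {u} {v} p q with v ≟ u
  ... | yes v≡u = contradiction (sym v≡u) (Adj⇒≢ p)
  ... | no  _   = refl

  peer-clustered : ∀ {u v w} (p : Adj X u v) (q : Adj X u w) →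
                   peer ((u , v) , p) ((u , w) , q) ≡ w
  peer-clustered {u} p q with u ≟ u
  ... | yes _   = refl
  ... | no  u≢u = contradiction refl u≢u

  peer-adjacent : ∀ x y → TAdj X x y → Adj X (proj₁ (proj₁ x)) (peer x y)
  peer-adjacent (_ , p) (_ , q) (inj₁ (refl , refl)) = subst (Adj X _) (sym (peer-matched p q)) p
  peer-adjacent (_ , p) (_ , q) (inj₂ (refl , _))    = subst (Adj X _) (sym (peer-clustered p q)) q

  peer-injective : ∀ x y z → TAdj X x y → TAdj X x z → peer x y ≡ peer x z → y ≡ z
  peer-injective (_ , p) (_ , q) (_ , r) (inj₁ (refl , refl)) (inj₁ (refl , refl)) _ =
    dart-≡ refl refl
  peer-injective (_ , p) (_ , q) (_ , r) (inj₁ (refl , refl)) (inj₂ (refl , v≢w)) e =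
    contradiction (trans (sym (peer-matched p q)) (trans e (peer-clustered p r))) v≢w
  peer-injective (_ , p) (_ , q) (_ , r) (inj₂ (refl , v≢w)) (inj₁ (refl , refl)) e =
    contradiction (trans (sym (peer-matched p r)) (trans (sym e) (peer-clustered p q))) v≢w
  peer-injective (_ , p) (_ , q) (_ , r) (inj₂ (refl , _)) (inj₂ (refl , _)) e =
    dart-≡ refl (trans (sym (peer-clustered p q)) (trans e (peer-clustered p r)))

  peer-surjective : ∀ {u v w} (p : Adj X u v) → Adj X u w →
                    ∃ λ y → TAdj X ((u , v) , p) y × peer ((u , v) , p) y ≡ w
  peer-surjective {u} {v} {w} p q with w ≟ v
  ... | yes refl = ((w , u) , Adj-sym p) , inj₁ (refl , refl) , peer-matched p (Adj-sym p)
  ... | no  w≢v  = ((u , w) , q) , inj₂ (refl , w≢v ∘ sym) , peer-clustered p q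

  module _ (L : NeighbourhoodLabelling X k) (S : CommutativeLatinSquare k) where
    open NeighbourhoodLabelling L
    open CommutativeLatinSquare S

    colour : TVertex X → TVertex X → Fin k
    colour x@((u , v) , _) y = label u v ∙ label u (peer x y)

    colour-injective : ∀ {x y z} → TAdj X x y → TAdj X x z → colour x y ≡ colour x z → y ≡ z
    colour-injective {x} {y} {z} xy xz e = peer-injective x y z xy xz
      (label-injective (peer-adjacent x y xy) (peer-adjacent x z xz) (∙-cancelˡ _ e))

    colour-surjective : ∀ x i → ∃ λ y → TAdj X x y × colour x y ≡ i
    colour-surjective x@((u , v) , p) i =
      let (b , b-solves)          = ∙-solveˡ (label u v) i
          (w , uw , w-labelled)   = label-surjective u b
          (y , xy , y-peer)       = peer-surjective p uw
      in y , xy , (begin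
        label u v ∙ label u (peer x y)   ≡⟨ cong ((label u v ∙_) ∘ label u) y-peer ⟩
        label u v ∙ label u w            ≡⟨ cong (label u v ∙_) w-labelled ⟩
        label u v ∙ b                    ≡⟨ b-solves ⟩
        i                                ∎)
      where open ≡-Reasoning

    colour-sym : (∀ {u v} → Adj X u v → label u v ∙ label u v ≡ label v u ∙ label v u) →
                 ∀ x y → TAdj X x y → colour x y ≡ colour y x
    colour-sym diagonal x@((u , v) , p) y@((_ , _) , q) (inj₁ (refl , refl)) = begin
      label u v ∙ label u (peer x y)   ≡⟨ cong ((label u v ∙_) ∘ label u) (peer-matched p q) ⟩
      label u v ∙ label u v            ≡⟨ diagonal p ⟩
      label v u ∙ label v u            ≡⟨ cong ((label v u ∙_) ∘ label v) (peer-matched q p) ⟨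
      label v u ∙ label v (peer y x)   ∎
      where open ≡-Reasoning
    colour-sym diagonal x@((u , v) , p) y@((_ , w) , q) (inj₂ (refl , _)) = begin
      label u v ∙ label u (peer x y)   ≡⟨ cong ((label u v ∙_) ∘ label u) (peer-clustered p q) ⟩
      label u v ∙ label u w            ≡⟨ ∙-comm _ _ ⟩
      label u w ∙ label u v            ≡⟨ cong ((label u w ∙_) ∘ label u) (peer-clustered q p) ⟨
      label u w ∙ label u (peer y x)   ∎
      where open ≡-Reasoning

    truncation-oneFactorization :
      (∀ {u v} → Adj X u v → label u v ∙ label u v ≡ label v u ∙ label v u) →
      OneFactorization (TAdj X)
    truncation-oneFactorization diagonal = properColouring⇒oneFactorization {A = TAdj X} colour
      (colour-sym diagonal) (λ {x y z} → colour-injective {x} {y} {z}) colour-surjective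

maxValency-≤ : ∀ (X : Graph n) {d} → Regular X d → maxValency X ≤ d
maxValency-≤ {n} X reg = bounded (allFin n)
  where
  bounded : ∀ vs → foldr _⊔_ 0 (map (degree X) vs) ≤ _
  bounded []       = z≤n
  bounded (v ∷ vs) = ⊔-lub (≤-reflexive (reg v)) (bounded vs)

proper⇒injective : ∀ (X : Graph n) (c : Fin n → Fin n → Fin k) →
  (∀ u v w → Adj X u v → Adj X u w → v ≢ w → c u v ≢ c u w) →
  LocallyInjective X c
proper⇒injective X c proper {u} {v} {w} p q e with v ≟ w
... | yes v≡w = v≡w
... | no  v≢w = contradiction e (proper u v w p q v≢w)

corollary7p2 : ∀ {n} (X : Graph n) (d : ℕ) → 0 < d → Regular X d →
    (2 ∣ d ⊎ ClassI X) → OneFactorization (TAdj X)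
corollary7p2 X (suc q) _ reg (inj₁ 2∣d) =
  truncation-oneFactorization (positionLabelling X reg) extension
    (λ {u} {v} _ → trans (∙⁺-diagonal (label u v)) (sym (∙⁺-diagonal (label v u))))
  where
  open NeighbourhoodLabelling (positionLabelling X reg)
  open DiagonalExtension (cyclic q) (⊕-double-injective (even⇒pred-odd 2∣d))
corollary7p2 X d _ reg (inj₂ ((c , c-sym , c-proper) , _)) =
  truncation-oneFactorization
    (regular⇒labelling X reg (maxValency-≤ X reg) c (proper⇒injective X c c-proper))
    (cyclic (maxValency X))
    (λ p → cong (λ a → a ⊕ a) (c-sym _ _ p))
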